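{- Let $n\ge5$, let $P_n$ be the path $v_1v_2\cdots v_n$, and let $\sigma$ be the signing of $P_n^2$ with $\sigma(e)=+1$ if $e\in E(P_n)$ and $\sigma(e)=-1$ otherwise. Then $d_\sigma(v_i,v_j)=0$ for all $i,j\in\{1,\dots,n\}$, except possibly when $n=6$ and $\{i,j\}=\{1,6\}$.
   Context: The square $H^2$ of a graph $H$ has vertex set $V(H)$, with $uv$ an edge iff $1\le d_H(u,v)\le2$; thus $P_n^2$ has edges $v_iv_{i+1}$ and $v_iv_{i+2}$. A signing is a map $\sigma:E\to\{\pm1\}$; for a path $P$, $\sigma(P)=\sum_{e\in P}\sigma(e)$; and $d_\sigma(u,v)=\min_P|\sigma(P)|$ over all $uv$-paths $P$ in the graph (here $P_n^2$), with $d_\sigma(u,u)=0$. -}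

module Defs where

open import Data.Nat using (ℕ; _≤_; ∣_-_∣)
open import Data.Fin using (Fin; toℕ)
open import Data.Integer using (ℤ; _+_; ∣_∣) renaming (+_ to ℤ+_; -_ to ℤ-_)
open import Data.List using (List; _∷_; [])
open import Data.List.Relation.Unary.Unique.Propositional using (Unique)
open import Data.Product using (Σ; _×_)
open import Data.Sum using (_⊎_)
open import Relation.Binary.PropositionalEquality using (_≡_; _≢_)

-- Vertices of P_n^2 : Fin n, where index k (0-based) stands for v_{k+1}.
data Adj {n : ℕ} (a b : Fin n) : Set where
  pathEdge   : ∣ toℕ a - toℕ b ∣ ≡ 1 → Adj a b
  squareEdge : ∣ toℕ a - toℕ b ∣ ≡ 2 → Adj a b

σ : ∀ {n} {a b : Fin n} → Adj a b → ℤ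
σ (pathEdge _)   = ℤ+ 1
σ (squareEdge _) = ℤ- (ℤ+ 1)

data Walk {n : ℕ} : Fin n → Fin n → Set where
  stop : (u : Fin n) → Walk u u
  step : ∀ {u w v} → Adj u w → Walk w v → Walk u v

vertices : ∀ {n} {u v : Fin n} → Walk u v → List (Fin n)
vertices (stop u) = u ∷ []
vertices (step {u = u} _ p) = u ∷ vertices p

IsPath : ∀ {n} {u v : Fin n} → Walk u v → Set
IsPath p = Unique (vertices p)

σ-sum : ∀ {n} {u v : Fin n} → Walk u v → ℤ
σ-sum (stop _)   = ℤ+ 0
σ-sum (step e p) = σ e + σ-sum p

Dσ : ∀ {n} → Fin n → Fin n → ℕ → Set
Dσ u v d =
  (u ≡ v × d ≡ 0) ⊎
  (u ≢ v ×
    (Σ (Walk u v) (λ P → IsPath P × ∣ σ-sum P ∣ ≡ d)) ×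
    ((P : Walk u v) → IsPath P → d ≤ ∣ σ-sum P ∣))

-- Every edge of P_n has sign +1 and every other edge −1, so it suffices to join v_i and
-- v_j (i < j, gap d = j − i) by a path using as many edges of P_n as non-edges.  The paths
-- v_a v_{a+1} v_{a+3} and v_a v_{a+2} v_{a+1} v_{a+3} v_{a+4} are balanced and stay between
-- their end points, so concatenating them settles every gap d ≥ 3 other than 5 (a sum of
-- 3s and 4s).  Gaps 1, 2 and 5 are bridged by short explicit paths that step below v_a, or,
-- near v_1, beyond v_j; for v_1 to v_6 this needs v_7, whence the exception n = 6.
-- Reversing a path handles i > j.

module Submission where

open import Defs
open import Data.Nat using (ℕ; suc; _+_; _∸_; _≤_; _<_; z≤n; s≤s; ∣_-_∣; _≤?_)
import Data.Nat as ℕ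
open import Data.Nat.Properties
  using (∣-∣-comm; +-cancelʳ-≡; ∣m+n-m+o∣≡∣n-o∣; +-comm; +-monoˡ-≤; ≤-<-trans; ≤-trans; ≤⇒≯; ≤∧≢⇒<; <⇒≤; <⇒≢; <-irrefl; <-cmp; m∸n+n≡m)
open import Data.Integer as ℤ using (ℤ; +_; -_)
import Data.Integer.Properties as ℤ
open import Data.Fin using (Fin; toℕ)
open import Data.Fin.Properties using (toℕ<n; toℕ-fromℕ<; toℕ-injective)
open import Data.List using (List; []; _∷_; _++_; map; reverse)
open import Data.List.Membership.Propositional using (_∈_)
open import Data.List.Properties using (unfold-reverse)
open import Data.List.Relation.Unary.All as All using (All; []; _∷_; all?)
import Data.List.Relation.Unary.All.Properties as All
open import Data.List.Relation.Unary.AllPairs using (_∷_)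
open import Data.List.Relation.Unary.Unique.Propositional using (Unique)
import Data.List.Relation.Unary.Unique.Propositional.Properties as Unique
open import Data.List.Relation.Unary.Unique.DecPropositional ℕ._≟_ using (unique?)
import Data.List.Relation.Binary.Permutation.Setoid as Perm
import Data.List.Relation.Binary.Permutation.Setoid.Properties as Perm
open import Data.Product using (_×_; _,_; proj₁; proj₂)
open import Data.Sum using (_⊎_; inj₁; inj₂)
open import Data.Empty using (⊥-elim)
open import Relation.Nullary using (¬_; Dec; yes; no; contradiction)
open import Relation.Nullary.Decidable using (True; toWitness; _×-dec_)
open import Relation.Unary using (Pred; Decidable)
open import Relation.Binary.Definitions using (tri<; tri≈; tri>)
open import Relation.Binary.PropositionalEquality
  using (_≡_; _≢_; refl; sym; trans; cong; cong₂; subst; setoid)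
open import Level using (0ℓ)

private
  variable
    a b c n u v w lo hi : ℕ
    P Q : Pred ℕ 0ℓ

∣m+o-n+o∣≡∣m-n∣ : ∀ m n o → ∣ m + o - n + o ∣ ≡ ∣ m - n ∣
∣m+o-n+o∣≡∣m-n∣ m n o
  rewrite +-comm m o | +-comm n o = ∣m+n-m+o∣≡∣n-o∣ o m n

-- Paths are built on ℕ, i.e. in the square of the infinite path, with adjacency given by
-- the same distance condition as Adj; those staying below n are then transported to Fin n.
data Step (u w : ℕ) : Set where
  short : ∣ u - w ∣ ≡ 1 → Step u w
  long  : ∣ u - w ∣ ≡ 2 → Step u w

step? : (u w : ℕ) → Dec (Step u w)
step? u w with ∣ u - w ∣ ℕ.≟ 1 | ∣ u - w ∣ ℕ.≟ 2
... | yes d | _     = yes (short d)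
... | no _  | yes d = yes (long d)
... | no ¬1 | no ¬2 = no λ { (short d) → ¬1 d ; (long d) → ¬2 d }

sign : Step u w → ℤ
sign (short _) = + 1
sign (long _)  = - + 1

data Route : ℕ → ℕ → Set where
  halt : ∀ u → Route u u
  move : Step u w → Route w v → Route u v

-- Explicit paths are written as vertex sequences, with adjacency decided by evaluation.
infixr 5 _⟶_

_⟶_ : ∀ u → Route w v → {True (step? u w)} → Route u v
(u ⟶ r) {s} = move (toWitness s) r

stops onward : Route u v → List ℕ
stops {u} r = u ∷ onward r
onward (halt _)   = []
onward (move _ r) = stops r

weight : Route u v → ℤ
weight (halt _)   = + 0
weight (move s r) = sign s ℤ.+ weight r

infixr 5 _++ᴿ_

_++ᴿ_ : Route u v → Route v w → Route u w
halt _   ++ᴿ r = r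
move s q ++ᴿ r = move s (q ++ᴿ r)

stops-++ : (q : Route u v) (r : Route v w) → stops (q ++ᴿ r) ≡ stops q ++ onward r
stops-++ (halt _)   r = refl
stops-++ (move {u} s q) r = cong (u ∷_) (stops-++ q r)

weight-++ : (q : Route u v) (r : Route v w) → weight (q ++ᴿ r) ≡ weight q ℤ.+ weight r
weight-++ (halt _)   r = sym (ℤ.+-identityˡ (weight r))
weight-++ (move s q) r =
  trans (cong (ℤ._+_ (sign s)) (weight-++ q r)) (sym (ℤ.+-assoc (sign s) (weight q) (weight r)))

reverseStep : Step u w → Step w u
reverseStep {u} {w} (short d) = short (trans (∣-∣-comm w u) d)
reverseStep {u} {w} (long d)  = long (trans (∣-∣-comm w u) d)

sign-reverseStep : (s : Step u w) → sign (reverseStep s) ≡ sign s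
sign-reverseStep (short _) = refl
sign-reverseStep (long _)  = refl

reverseᴿ : Route u v → Route v u
reverseᴿ (halt u)     = halt u
reverseᴿ (move {u} s r) = reverseᴿ r ++ᴿ move (reverseStep s) (halt u)

stops-reverse : (r : Route u v) → stops (reverseᴿ r) ≡ reverse (stops r)
stops-reverse (halt _) = refl
stops-reverse (move {u} s r) =
  trans (stops-++ (reverseᴿ r) (move (reverseStep s) (halt u)))
        (trans (cong (_++ u ∷ []) (stops-reverse r)) (sym (unfold-reverse u (stops r))))

weight-reverse : (r : Route u v) → weight (reverseᴿ r) ≡ weight r
weight-reverse (halt _) = refl
weight-reverse (move {u} s r) =
  trans (weight-++ (reverseᴿ r) (move (reverseStep s) (halt u)))
        (trans (cong₂ ℤ._+_ (weight-reverse r) (trans (ℤ.+-identityʳ _) (sign-reverseStep s)))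
               (ℤ.+-comm (weight r) (sign s)))

shiftStep : ∀ c → Step u w → Step (u + c) (w + c)
shiftStep {u} {w} c (short d) = short (trans (∣m+o-n+o∣≡∣m-n∣ u w c) d)
shiftStep {u} {w} c (long d)  = long (trans (∣m+o-n+o∣≡∣m-n∣ u w c) d)

sign-shift : ∀ c (s : Step u w) → sign (shiftStep c s) ≡ sign s
sign-shift c (short _) = refl
sign-shift c (long _)  = refl

shiftᴿ : ∀ c → Route u v → Route (u + c) (v + c)
shiftᴿ c (halt u)   = halt (u + c)
shiftᴿ c (move s r) = move (shiftStep c s) (shiftᴿ c r)

stops-shift : ∀ c (r : Route u v) → stops (shiftᴿ c r) ≡ map (_+ c) (stops r)
stops-shift c (halt _)   = refl
stops-shift c (move {u} s r) = cong (u + c ∷_) (stops-shift c r)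

weight-shift : ∀ c (r : Route u v) → weight (shiftᴿ c r) ≡ weight r
weight-shift c (halt _)   = refl
weight-shift c (move s r) = cong₂ ℤ._+_ (sign-shift c s) (weight-shift c r)

record BalancedRoute (P : Pred ℕ 0ℓ) (u v : ℕ) : Set where
  field
    route    : Route u v
    distinct : Unique (stops route)
    inside   : All P (stops route)
    balanced : weight route ≡ + 0

open BalancedRoute

certify : (P? : Decidable P) (r : Route u v) →
          {True (unique? (stops r))} → {True (all? P? (stops r))} → {True (weight r ℤ.≟ + 0)} →
          BalancedRoute P u v
certify P? r {d} {i} {z} = record
  { route = r ; distinct = toWitness d ; inside = toWitness i ; balanced = toWitness z }

weaken : (∀ {x} → P x → Q x) → BalancedRoute P u v → BalancedRoute Q u v
route    (weaken P⇒Q p) = route p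
distinct (weaken P⇒Q p) = distinct p
inside   (weaken P⇒Q p) = All.map P⇒Q (inside p)
balanced (weaken P⇒Q p) = balanced p

shift : ∀ c → (∀ {x} → P x → Q (x + c)) → BalancedRoute P u v → BalancedRoute Q (u + c) (v + c)
route    (shift c P⇒Q p) = shiftᴿ c (route p)
distinct (shift c P⇒Q p) = subst Unique (sym (stops-shift c (route p)))
  (Unique.map⁺ (λ {x} {y} → +-cancelʳ-≡ c x y) (distinct p))
inside   (shift c P⇒Q p) = subst (All _) (sym (stops-shift c (route p)))
  (All.map⁺ (All.map P⇒Q (inside p)))
balanced (shift c P⇒Q p) = trans (weight-shift c (route p)) (balanced p)

reverseBalanced : BalancedRoute P u v → BalancedRoute P v u
route    (reverseBalanced p) = reverseᴿ (route p)
distinct (reverseBalanced p) = subst Unique (sym (stops-reverse (route p)))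
  (Perm.Unique-resp-↭ (setoid ℕ) (Perm.↭-sym (setoid ℕ) (Perm.↭-reverse (setoid ℕ) _)) (distinct p))
inside   (reverseBalanced p) = subst (All _) (sym (stops-reverse (route p)))
  (Perm.All-resp-↭ (setoid ℕ) (λ { refl Px → Px }) (Perm.↭-sym (setoid ℕ) (Perm.↭-reverse (setoid ℕ) _)) (inside p))
balanced (reverseBalanced p) = trans (weight-reverse (route p)) (balanced p)

Interval : ℕ → ℕ → Pred ℕ 0ℓ
Interval lo hi x = lo ≤ x × x ≤ hi

interval? : ∀ lo hi → Decidable (Interval lo hi)
interval? lo hi x = (lo ≤? x) ×-dec (x ≤? hi)

shiftInterval : ∀ c → BalancedRoute (Interval lo hi) u v →
                BalancedRoute (Interval (lo + c) (hi + c)) (u + c) (v + c)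
shiftInterval c = shift c λ (lo≤x , x≤hi) → +-monoˡ-≤ c lo≤x , +-monoˡ-≤ c x≤hi

below : hi < n → BalancedRoute (Interval lo hi) u v → BalancedRoute (_< n) u v
below hi<n = weaken λ (_ , x≤hi) → ≤-<-trans x≤hi hi<n

Segment : ℕ → ℕ → Set
Segment a b = BalancedRoute (Interval a b) a b

infixr 5 _++ˢ_

_++ˢ_ : Segment a b → Segment b c → Segment a c
route    (p ++ˢ q) = route p ++ᴿ route q
distinct (p ++ˢ q) with distinct q
... | b∉onward ∷ onward-distinct =
  subst Unique (sym (stops-++ (route p) (route q)))
    (Unique.++⁺ (distinct p) onward-distinct disjoint)
  where
  disjoint : ∀ {x} → ¬ (x ∈ stops (route p) × x ∈ onward (route q))
  disjoint (x∈p , x∈q) = ≤⇒≯ (proj₂ (All.lookup (inside p) x∈p))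
    (≤∧≢⇒< (proj₁ (All.lookup (All.tail (inside q)) x∈q)) (All.lookup b∉onward x∈q))
inside   (_++ˢ_ {a} {b} {c} p q) = subst (All _) (sym (stops-++ (route p) (route q)))
  (All.++⁺ (All.map (λ (a≤x , x≤b) → a≤x , ≤-trans x≤b b≤c) (inside p))
           (All.map (λ (b≤x , x≤c) → ≤-trans a≤b b≤x , x≤c) (All.tail (inside q))))
  where
  a≤b : a ≤ b
  a≤b = proj₂ (All.head (inside p))
  b≤c : b ≤ c
  b≤c = proj₂ (All.head (inside q))
balanced (p ++ˢ q) = trans (weight-++ (route p) (route q)) (cong₂ ℤ._+_ (balanced p) (balanced q))

segment₃ : ∀ a → Segment a (3 + a)
segment₃ a = shiftInterval a (certify (interval? 0 3) (0 ⟶ 1 ⟶ halt 3))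

segment₄ : ∀ a → Segment a (4 + a)
segment₄ a = shiftInterval a (certify (interval? 0 4) (0 ⟶ 2 ⟶ 1 ⟶ 3 ⟶ halt 4))

segment : ∀ d → 3 ≤ d → d ≢ 5 → ∀ a → Segment a (d + a)
segment 1 (s≤s ()) _
segment 2 (s≤s (s≤s ())) _
segment 3 _ _ = segment₃
segment 4 _ _ = segment₄
segment 5 _ 5≢5 = contradiction refl 5≢5
segment 6 _ _ a = segment₃ a ++ˢ segment₃ (3 + a)
segment 7 _ _ a = segment₄ a ++ˢ segment₃ (4 + a)
segment 8 _ _ a = segment₄ a ++ˢ segment₄ (4 + a)
segment (suc (suc (suc d@(suc (suc (suc (suc (suc (suc _))))))))) _ _ a =
  segment d (s≤s (s≤s (s≤s z≤n))) (λ ()) a ++ˢ segment₃ (d + a)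

balancedAtGap : 5 ≤ n → ∀ d a → a < d + a → d + a < n → ¬ (n ≡ 6 × a ≡ 0 × d + a ≡ 5) →
                BalancedRoute (_< n) a (d + a)
balancedAtGap _ 0 a a<a _ _ = ⊥-elim (<-irrefl refl a<a)
balancedAtGap 5≤n 1 0 _ _ _ =
  below (≤-trans (s≤s (s≤s (s≤s z≤n))) 5≤n) (certify (interval? 0 2) (0 ⟶ 2 ⟶ halt 1))
balancedAtGap _ 1 (suc c) _ b<n _ =
  below b<n (shiftInterval c (certify (interval? 0 2) (1 ⟶ 0 ⟶ halt 2)))
balancedAtGap 5≤n 2 0 _ _ _ =
  below 5≤n (certify (interval? 0 4) (0 ⟶ 1 ⟶ 3 ⟶ 4 ⟶ halt 2))
balancedAtGap 5≤n 2 1 _ _ _ =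
  below 5≤n (certify (interval? 0 4) (1 ⟶ 0 ⟶ 2 ⟶ 4 ⟶ halt 3))
balancedAtGap _ 2 (suc (suc c)) _ b<n _ =
  below b<n (shiftInterval c (certify (interval? 0 4) (2 ⟶ 0 ⟶ 1 ⟶ 3 ⟶ halt 4)))
balancedAtGap _ 3 a _ b<n _ = below b<n (segment₃ a)
balancedAtGap _ 4 a _ b<n _ = below b<n (segment₄ a)
balancedAtGap _ 5 0 _ 5<n exception =
  below (≤∧≢⇒< 5<n λ 6≡n → exception (sym 6≡n , refl , refl))
        (certify (interval? 0 6) (0 ⟶ 1 ⟶ 3 ⟶ 2 ⟶ 4 ⟶ 6 ⟶ halt 5))
balancedAtGap _ 5 (suc c) _ b<n _ =
  below b<n (shiftInterval c (certify (interval? 0 6) (1 ⟶ 0 ⟶ 2 ⟶ 3 ⟶ 5 ⟶ 4 ⟶ halt 6)))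
balancedAtGap _ d@(suc (suc (suc (suc (suc (suc _)))))) a _ b<n _ =
  below b<n (segment d (s≤s (s≤s (s≤s z≤n))) (λ ()) a)

balancedRoute : 5 ≤ n → a < b → b < n → ¬ (n ≡ 6 × a ≡ 0 × b ≡ 5) → BalancedRoute (_< n) a b
balancedRoute {a = a} {b} 5≤n a<b with b ∸ a | m∸n+n≡m (<⇒≤ a<b)
... | d | refl = balancedAtGap 5≤n d a a<b

module _ {n : ℕ} where

  toAdj : Step u w → {a b : Fin n} → toℕ a ≡ u → toℕ b ≡ w → Adj a b
  toAdj (short d) refl refl = pathEdge d
  toAdj (long d)  refl refl = squareEdge d

  σ-toAdj : (s : Step u w) {a b : Fin n} (a≡u : toℕ a ≡ u) (b≡w : toℕ b ≡ w) →
            σ (toAdj s a≡u b≡w) ≡ sign s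
  σ-toAdj (short _) refl refl = refl
  σ-toAdj (long _)  refl refl = refl

  toWalk : (r : Route u v) → All (_< n) (onward r) → {a b : Fin n} → toℕ a ≡ u → toℕ b ≡ v → Walk a b
  toWalk (halt _) [] a≡u b≡u with toℕ-injective (trans a≡u (sym b≡u))
  ... | refl = stop _
  toWalk (move s r) (w<n ∷ r<n) a≡u b≡v =
    step (toAdj s a≡u (toℕ-fromℕ< w<n)) (toWalk r r<n (toℕ-fromℕ< w<n) b≡v)

  vertices-toWalk : (r : Route u v) (r<n : All (_< n) (onward r)) {a b : Fin n}
                    (a≡u : toℕ a ≡ u) (b≡v : toℕ b ≡ v) →
                    map toℕ (vertices (toWalk r r<n a≡u b≡v)) ≡ stops r
  vertices-toWalk (halt _) [] a≡u b≡u with toℕ-injective (trans a≡u (sym b≡u))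
  ... | refl = cong (_∷ []) a≡u
  vertices-toWalk (move s r) (w<n ∷ r<n) a≡u b≡v =
    cong₂ _∷_ a≡u (vertices-toWalk r r<n (toℕ-fromℕ< w<n) b≡v)

  σ-sum-toWalk : (r : Route u v) (r<n : All (_< n) (onward r)) {a b : Fin n}
                 (a≡u : toℕ a ≡ u) (b≡v : toℕ b ≡ v) →
                 σ-sum (toWalk r r<n a≡u b≡v) ≡ weight r
  σ-sum-toWalk (halt _) [] a≡u b≡u with toℕ-injective (trans a≡u (sym b≡u))
  ... | refl = refl
  σ-sum-toWalk (move s r) (w<n ∷ r<n) a≡u b≡v =
    cong₂ ℤ._+_ (σ-toAdj s a≡u (toℕ-fromℕ< w<n)) (σ-sum-toWalk r r<n (toℕ-fromℕ< w<n) b≡v)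

  Dσ≡0 : {a b : Fin n} → a ≢ b → BalancedRoute (_< n) (toℕ a) (toℕ b) → Dσ a b 0
  Dσ≡0 {a} {b} a≢b p = inj₂ (a≢b , (walk , path , zero-sum) , λ _ _ → z≤n)
    where
    r : Route (toℕ a) (toℕ b)
    r = route p
    r<n : All (_< n) (onward r)
    r<n = All.tail (inside p)
    walk : Walk a b
    walk = toWalk r r<n refl refl
    path : IsPath walk
    path = Unique.map⁻ (subst Unique (sym (vertices-toWalk r r<n refl refl)) (distinct p))
    zero-sum : ℤ.∣ σ-sum walk ∣ ≡ 0
    zero-sum = cong ℤ.∣_∣ (trans (σ-sum-toWalk r r<n refl refl) (balanced p))

lemma2p1 : (n : ℕ) → 5 ≤ n → (i j : Fin n) →
    ¬ (n ≡ 6 × ((toℕ i ≡ 0 × toℕ j ≡ 5) ⊎ (toℕ i ≡ 5 × toℕ j ≡ 0))) →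
    Dσ i j 0
lemma2p1 n 5≤n i j exception with <-cmp (toℕ i) (toℕ j)
... | tri≈ _ i≡j _ = inj₁ (toℕ-injective i≡j , refl)
... | tri< i<j _ _ = Dσ≡0 (λ i≡j → <⇒≢ i<j (cong toℕ i≡j))
  (balancedRoute 5≤n i<j (toℕ<n j) λ (n≡6 , i≡0 , j≡5) → exception (n≡6 , inj₁ (i≡0 , j≡5)))
... | tri> _ _ j<i = Dσ≡0 (λ i≡j → <⇒≢ j<i (cong toℕ (sym i≡j)))
  (reverseBalanced (balancedRoute 5≤n j<i (toℕ<n i) λ (n≡6 , j≡0 , i≡5) → exception (n≡6 , inj₂ (i≡5 , j≡0))))
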